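{- Let $q$ be a prime power, $n,m$ positive integers, $E=\mathbb{F}_q^n$, and let $\mathcal{C}$ be an $\mathbb{F}_q$-linear subspace of $\mathrm{Mat}(n\times m,\mathbb{F}_q)$. Let $P_{\mathcal{C}}=(E,\rho)$ with $\rho(J)=\dim_{\mathbb{F}_q}\mathcal{C}-\dim_{\mathbb{F}_q}\mathcal{C}(J^{\perp})$, and let $P_{\mathcal{C}^{\perp}}=(E,\tau)$ with $\tau(J)=\dim_{\mathbb{F}_q}\mathcal{C}^{\perp}-\dim_{\mathbb{F}_q}\mathcal{C}^{\perp}(J^{\perp})$. Then $P_{\mathcal{C}}^{*}=P_{\mathcal{C}^{\perp}}$, i.e. for every subspace $J$ of $E$, $\rho(J^{\perp})+m\dim J-\rho(E)=\tau(J)$.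
   Context: For a subspace $J\le E$ and an $\mathbb{F}_q$-subspace $\mathcal{D}$ of $\mathrm{Mat}(n\times m,\mathbb{F}_q)$, $\mathcal{D}(J):=\{M\in\mathcal{D}:\mathrm{col}(M)\subseteq J\}$ with $\mathrm{col}(M)$ the column space; $J^{\perp}$ is the orthogonal complement of $J$ for the standard dot product. $\mathcal{C}^{\perp}:=\{N:\mathrm{Tr}(MN^{T})=0\ \forall M\in\mathcal{C}\}$. The dual of a $(q,m)$-polymatroid $P=(E,\rho)$ is $P^*=(E,\rho^*)$ with $\rho^*(J):=\rho(J^{\perp})+m\dim J-\rho(E)$. -}

module Defs where

open import Level using (0ℓ)
open import Data.Nat using (ℕ) renaming (zero to nzero; suc to nsuc)
open import Data.Fin using (Fin)
import Data.Fin as Fin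
open import Data.Product using (Σ; _×_; _,_; ∃)
open import Data.Unit using (⊤)
open import Algebra.Bundles using (CommutativeRing)
open import Relation.Nullary using (¬_)
open import Relation.Binary.PropositionalEquality using (_≡_)

record Field : Set₁ where
  field
    commRing : CommutativeRing 0ℓ 0ℓ
  open CommutativeRing commRing public
  field
    0≉1     : ¬ (0# ≈ 1#)
    inverse : ∀ x → ¬ (x ≈ 0#) → Σ Carrier λ y → (x * y) ≈ 1#

-- F is finite with exactly q elements: a bijection (up to ≈) Fin q ≅ Carrier.
-- (A finite field has prime-power order, so q is a prime power.)
record HasCard (F : Field) (q : ℕ) : Set where
  open Field F
  field
    enum     : Fin q → Carrier
    enum-inj : ∀ i j → enum i ≈ enum j → i ≡ j
    enum-sur : ∀ x → Σ (Fin q) λ i → enum i ≈ x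

module _ (F : Field) where
  open Field F

  sumF : (k : ℕ) → (Fin k → Carrier) → Carrier
  sumF nzero   f = 0#
  sumF (nsuc k) f = f Fin.zero + sumF k (λ i → f (Fin.suc i))

  _≋_ : {A : Set} → (A → Carrier) → (A → Carrier) → Set
  u ≋ v = ∀ a → u a ≈ v a

  record IsSubspace {A : Set} (V : (A → Carrier) → Set) : Set where
    field
      resp  : ∀ {u v} → u ≋ v → V u → V v
      zero∈ : V (λ _ → 0#)
      +∈    : ∀ {u v} → V u → V v → V (λ a → u a + v a)
      ·∈    : ∀ (c : Carrier) {u} → V u → V (λ a → c * u a)

  lincomb : {A : Set} (d : ℕ) → (Fin d → Carrier) → (Fin d → A → Carrier) → A → Carrier
  lincomb d c b a = sumF d (λ k → c k * b k a)

  record HasDim {A : Set} (V : (A → Carrier) → Set) (d : ℕ) : Set where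
    field
      basis     : Fin d → A → Carrier
      basis∈    : ∀ k → V (basis k)
      indep     : ∀ (c : Fin d → Carrier) → lincomb d c basis ≋ (λ _ → 0#) → ∀ k → c k ≈ 0#
      spanning  : ∀ v → V v → Σ (Fin d → Carrier) λ c → v ≋ lincomb d c basis

  Vecⁿ : ℕ → Set
  Vecⁿ n = Fin n → Carrier

  Mat : ℕ → ℕ → Set
  Mat n m = Fin n × Fin m → Carrier

  dot : (n : ℕ) → Vecⁿ n → Vecⁿ n → Carrier
  dot n x y = sumF n (λ i → x i * y i)

  wholeSpace : (n : ℕ) → Vecⁿ n → Set
  wholeSpace n _ = ⊤

  perp : (n : ℕ) → (Vecⁿ n → Set) → Vecⁿ n → Set
  perp n J x = ∀ y → J y → dot n x y ≈ 0#

  column : {n m : ℕ} → Mat n m → Fin m → Vecⁿ n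
  column M j i = M (i , j)

  -- col(M) ⊆ J  (J a subspace, so it suffices that every column lies in J)
  colIn : {n m : ℕ} → (Vecⁿ n → Set) → Mat n m → Set
  colIn {m = m} J M = ∀ (j : Fin m) → J (column M j)

  restrict : {n m : ℕ} → (Mat n m → Set) → (Vecⁿ n → Set) → Mat n m → Set
  restrict D J M = D M × colIn J M

  trMNᵀ : (n m : ℕ) → Mat n m → Mat n m → Carrier
  trMNᵀ n m M N = sumF n (λ i → sumF m (λ j → M (i , j) * N (i , j)))

  dualCode : (n m : ℕ) → (Mat n m → Set) → Mat n m → Set
  dualCode n m C N = ∀ M → C M → trMNᵀ n m M N ≈ 0#

module Submission where

-- Everything rests on one fact of finite-dimensional linear algebra, proved by
-- Gaussian elimination (induction on the number of forms): for a subspace W of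
-- dimension k and linear forms f₀ … f_{r-1}, there is a rank t such that the
-- common kernel of the fᵢ in W has dimension k − t, the space of relations
-- {a | Σ aᵢ fᵢ = 0 on W} has dimension r − t, and every form vanishing on the
-- common kernel agrees on W with some Σ aᵢ fᵢ (`eliminate`).  It yields the
-- uniqueness of dimension and V⊥⊥ ⊆ V for subspaces of F^A, A finite with its
-- standard pairing; the latter covers J ≤ Fⁿ with the dot product and codes
-- C ≤ Mat(n × m) with the trace pairing.
--
-- For the proposition we eliminate with W = C⊥ and the m·dim J forms
-- N ↦ (column j of N)·b_k, where b is a basis of J.  Their common kernel is
-- C⊥(J⊥); a relation γ is the same as the matrix X whose j-th column is
-- Σ_k γ_{jk} b_k lying in C⊥⊥ = C, i.e. an element of C(J) = C(J⊥⊥).  Hence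
--   dim C⊥ − dim C⊥(J⊥) = t = m·dim J − dim C(J⊥⊥),
-- and since C(E⊥) = 0 the stated identity is integer arithmetic.

open import Defs
open import Data.Nat as ℕ using (ℕ; NonZero) renaming (zero to nzero; suc to nsuc)
import Data.Nat.Properties as ℕP
open import Data.Fin as Fin using (Fin; zero; suc; _↑ʳ_; combine; remQuot; punchIn; punchOut)
open import Data.Fin.Properties
  using (suc-injective; punchInᵢ≢i; punchOut-punchIn; punchOut-cong; remQuot-combine; combine-remQuot; *↔×)
open import Data.Vec.Functional using (_∷_)
open import Data.Product using (Σ; _×_; _,_; proj₁; proj₂)
open import Data.Sum using (_⊎_; inj₁; inj₂)
open import Data.Empty using (⊥-elim)
open import Data.Unit using (⊤; tt)
open import Relation.Nullary using (¬_; Dec; yes; no)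
open import Relation.Binary.PropositionalEquality as P using (_≡_)
open import Function.Bundles using (_↔_; Inverse)
open import Function.Construct.Identity using (↔-id)
import Algebra.Properties.Ring as RingProperties
import Algebra.Properties.CommutativeSemigroup as CommutativeSemigroupProperties

module LinearAlgebra (F : Field) where
  open Field F hiding (zero)
  open import Relation.Binary.Reasoning.Setoid setoid
  open RingProperties ring
    using (-‿distribˡ-*; -‿distribʳ-*; -‿+-comm; -‿involutive; +-inverseˡ-unique; -1*x≈-x)
  open CommutativeSemigroupProperties +-commutativeSemigroup using (interchange) renaming (x∙yz≈y∙xz to +-exchange)
  open CommutativeSemigroupProperties *-commutativeSemigroup using () renaming (x∙yz≈y∙xz to *-exchange)

  Pred : Set → Set₁
  Pred A = (A → Carrier) → Set

  _≐_ : {A : Set} → (A → Carrier) → (A → Carrier) → Set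
  _≐_ = Defs._≋_ F

  sum : (k : ℕ) → (Fin k → Carrier) → Carrier
  sum = sumF F

  lc : {A : Set} (d : ℕ) → (Fin d → Carrier) → (Fin d → A → Carrier) → A → Carrier
  lc = lincomb F

  sum-cong : ∀ k {f g : Fin k → Carrier} → (∀ i → f i ≈ g i) → sum k f ≈ sum k g
  sum-cong nzero    f≈g = refl
  sum-cong (nsuc k) f≈g = +-cong (f≈g zero) (sum-cong k (λ i → f≈g (suc i)))

  sum-zero : ∀ k {f : Fin k → Carrier} → (∀ i → f i ≈ 0#) → sum k f ≈ 0#
  sum-zero nzero    f≈0 = refl
  sum-zero (nsuc k) f≈0 = trans (+-cong (f≈0 zero) (sum-zero k (λ i → f≈0 (suc i)))) (+-identityʳ 0#)

  sum-+ : ∀ k (f g : Fin k → Carrier) → sum k (λ i → f i + g i) ≈ sum k f + sum k g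
  sum-+ nzero    f g = sym (+-identityʳ 0#)
  sum-+ (nsuc k) f g = trans (+-cong refl (sum-+ k _ _)) (interchange _ _ _ _)

  sum-*ˡ : ∀ k c (f : Fin k → Carrier) → sum k (λ i → c * f i) ≈ c * sum k f
  sum-*ˡ nzero    c f = sym (zeroʳ c)
  sum-*ˡ (nsuc k) c f = trans (+-cong refl (sum-*ˡ k c _)) (sym (distribˡ c _ _))

  sum-*ʳ : ∀ k c (f : Fin k → Carrier) → sum k (λ i → f i * c) ≈ sum k f * c
  sum-*ʳ nzero    c f = sym (zeroˡ c)
  sum-*ʳ (nsuc k) c f = trans (+-cong refl (sum-*ʳ k c _)) (sym (distribʳ c _ _))

  sum-neg : ∀ k (f : Fin k → Carrier) → sum k (λ i → - f i) ≈ - sum k f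
  sum-neg k f = begin
    sum k (λ i → - f i)       ≈⟨ sum-cong k (λ i → sym (-1*x≈-x (f i))) ⟩
    sum k (λ i → - 1# * f i)  ≈⟨ sum-*ˡ k (- 1#) f ⟩
    - 1# * sum k f            ≈⟨ -1*x≈-x _ ⟩
    - sum k f                 ∎

  sum-swap : ∀ a b (f : Fin a → Fin b → Carrier) →
    sum a (λ i → sum b (f i)) ≈ sum b (λ j → sum a (λ i → f i j))
  sum-swap nzero    b f = sym (sum-zero b (λ _ → refl))
  sum-swap (nsuc a) b f = trans (+-cong refl (sum-swap a b (λ i → f (suc i)))) (sym (sum-+ b _ _))

  sum-combine : ∀ a b (f : Fin (a ℕ.* b) → Carrier) →
    sum (a ℕ.* b) f ≈ sum a (λ i → sum b (λ j → f (combine i j)))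
  sum-combine nzero    b f = refl
  sum-combine (nsuc a) b f = trans (sum-append b (a ℕ.* b) f) (+-cong refl (sum-combine a b (λ k → f (b ↑ʳ k))))
    where
    sum-append : ∀ a b (f : Fin (a ℕ.+ b) → Carrier) →
      sum (a ℕ.+ b) f ≈ sum a (λ i → f (i Fin.↑ˡ b)) + sum b (λ j → f (a ↑ʳ j))
    sum-append nzero    b f = sym (+-identityˡ _)
    sum-append (nsuc a) b f = trans (+-cong refl (sum-append a b (λ i → f (suc i)))) (sym (+-assoc _ _ _))

  sum-punchIn : ∀ k (f : Fin (nsuc k) → Carrier) (p : Fin (nsuc k)) →
    sum (nsuc k) f ≈ f p + sum k (λ i → f (punchIn p i))
  sum-punchIn k        f zero    = refl
  sum-punchIn (nsuc k) f (suc p) = begin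
    f zero + sum (nsuc k) (λ i → f (suc i))
      ≈⟨ +-cong refl (sum-punchIn k (λ i → f (suc i)) p) ⟩
    f zero + (f (suc p) + sum k (λ i → f (suc (punchIn p i))))
      ≈⟨ +-exchange _ _ _ ⟩
    f (suc p) + (f zero + sum k (λ i → f (suc (punchIn p i)))) ∎

  δ : ∀ {k} → Fin k → Fin k → Carrier
  δ i j with i Fin.≟ j
  ... | yes _ = 1#
  ... | no  _ = 0#

  δ-diag : ∀ {k} (i : Fin k) → δ i i ≈ 1#
  δ-diag i with i Fin.≟ i
  ... | yes _  = refl
  ... | no i≢i = ⊥-elim (i≢i P.refl)

  δ-off : ∀ {k} (i j : Fin k) → ¬ i ≡ j → δ i j ≈ 0#
  δ-off i j i≢j with i Fin.≟ j
  ... | yes i≡j = ⊥-elim (i≢j i≡j)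
  ... | no  _   = refl

  δ-sym : ∀ {k} (i j : Fin k) → δ i j ≈ δ j i
  δ-sym i j with i Fin.≟ j | j Fin.≟ i
  ... | yes _   | yes _   = refl
  ... | no  _   | no  _   = refl
  ... | yes i≡j | no  j≢i = ⊥-elim (j≢i (P.sym i≡j))
  ... | no  i≢j | yes j≡i = ⊥-elim (i≢j (P.sym j≡i))

  δ-suc : ∀ {k} (i j : Fin k) → δ (suc i) (suc j) ≈ δ i j
  δ-suc i j = byCases (i Fin.≟ j)
    where
    byCases : Dec (i ≡ j) → δ (suc i) (suc j) ≈ δ i j
    byCases (yes P.refl) = trans (δ-diag (suc i)) (sym (δ-diag i))
    byCases (no i≢j)     = trans (δ-off (suc i) (suc j) (λ e → i≢j (suc-injective e))) (sym (δ-off i j i≢j))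

  sum-δ : ∀ k (f : Fin k → Carrier) (j : Fin k) → sum k (λ i → f i * δ i j) ≈ f j
  sum-δ (nsuc k) f zero = begin
    f zero * δ {nsuc k} zero zero + sum k (λ i → f (suc i) * δ (suc i) zero)
      ≈⟨ +-cong (*-cong refl (δ-diag {nsuc k} zero)) (sum-zero k (λ i → trans (*-cong refl (δ-off (suc i) zero (λ ()))) (zeroʳ _))) ⟩
    f zero * 1# + 0#  ≈⟨ trans (+-identityʳ _) (*-identityʳ _) ⟩
    f zero            ∎
  sum-δ (nsuc k) f (suc j) = begin
    f zero * δ zero (suc j) + sum k (λ i → f (suc i) * δ (suc i) (suc j))
      ≈⟨ +-cong (trans (*-cong refl (δ-off zero (suc j) (λ ()))) (zeroʳ _)) (sum-cong k (λ i → *-cong refl (δ-suc i j))) ⟩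
    0# + sum k (λ i → f (suc i) * δ i j)  ≈⟨ trans (+-identityˡ _) (sum-δ k (λ i → f (suc i)) j) ⟩
    f (suc j)                             ∎

  lc-lc : ∀ {A} d e (c : Fin d → Carrier) (α : Fin d → Fin e → Carrier) (b : Fin e → A → Carrier) a →
    sum d (λ l → c l * lc e (α l) b a) ≈ lc e (λ k → sum d (λ l → c l * α l k)) b a
  lc-lc d e c α b a = begin
    sum d (λ l → c l * sum e (λ k → α l k * b k a))    ≈⟨ sum-cong d (λ l → sym (sum-*ˡ e _ _)) ⟩
    sum d (λ l → sum e (λ k → c l * (α l k * b k a)))  ≈⟨ sum-swap d e _ ⟩
    sum e (λ k → sum d (λ l → c l * (α l k * b k a)))  ≈⟨ sum-cong e (λ k → trans (sum-cong d (λ l → sym (*-assoc _ _ _))) (sum-*ʳ d _ _)) ⟩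
    sum e (λ k → sum d (λ l → c l * α l k) * b k a)    ∎

  record LinearForm (A : Set) : Set where
    field
      ap   : (A → Carrier) → Carrier
      resp : ∀ {u v} → u ≐ v → ap u ≈ ap v
      ap-+ : ∀ u v → ap (λ a → u a + v a) ≈ ap u + ap v
      ap-* : ∀ c u → ap (λ a → c * u a) ≈ c * ap u
  open LinearForm public

  ap-zero : ∀ {A} (g : LinearForm A) → ap g (λ _ → 0#) ≈ 0#
  ap-zero g = begin
    ap g (λ _ → 0#)       ≈⟨ resp g (λ _ → sym (zeroˡ 0#)) ⟩
    ap g (λ _ → 0# * 0#)  ≈⟨ ap-* g 0# (λ _ → 0#) ⟩
    0# * ap g (λ _ → 0#)  ≈⟨ zeroˡ _ ⟩
    0#                    ∎

  ap-axpy : ∀ {A} (g : LinearForm A) (x y : A → Carrier) c → ap g (λ a → x a + c * y a) ≈ ap g x + c * ap g y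
  ap-axpy g x y c = trans (ap-+ g x (λ a → c * y a)) (+-cong refl (ap-* g c y))

  reshape : ∀ {A} (g : LinearForm A) (h : (A → Carrier) → Carrier) → (∀ v → h v ≈ ap g v) → LinearForm A
  reshape g h h≈g = record
    { ap   = h
    ; resp = λ u≐v → trans (h≈g _) (trans (resp g u≐v) (sym (h≈g _)))
    ; ap-+ = λ u v → trans (h≈g _) (trans (ap-+ g u v) (sym (+-cong (h≈g u) (h≈g v))))
    ; ap-* = λ c u → trans (h≈g _) (trans (ap-* g c u) (sym (*-cong refl (h≈g u)))) }

  ap-lc : ∀ {A} (g : LinearForm A) d c (b : Fin d → A → Carrier) →
    ap g (lc d c b) ≈ sum d (λ k → c k * ap g (b k))
  ap-lc g nzero    c b = ap-zero g
  ap-lc g (nsuc d) c b =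
    trans (ap-+ g _ _) (+-cong (ap-* g (c zero) (b zero)) (ap-lc g d (λ k → c (suc k)) (λ k → b (suc k))))

  combination : ∀ {A} r → (Fin r → Carrier) → (Fin r → LinearForm A) → (A → Carrier) → Carrier
  combination r a f w = sum r (λ i → a i * ap (f i) w)

  combination-0∷ : ∀ {A} r (a : Fin r → Carrier) (f : Fin (nsuc r) → LinearForm A) w →
    combination (nsuc r) (0# ∷ a) f w ≈ combination r a (λ i → f (suc i)) w
  combination-0∷ r a f w = trans (+-cong (zeroˡ _) refl) (+-identityˡ _)

  subtractMultiple : ∀ {A} → LinearForm A → Carrier → LinearForm A → LinearForm A
  subtractMultiple g μ f = record
    { ap   = λ v → ap g v + - (μ * ap f v)
    ; resp = λ u≐v → +-cong (resp g u≐v) (-‿cong (*-cong refl (resp f u≐v)))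
    ; ap-+ = λ u v → begin
        ap g (λ a → u a + v a) + - (μ * ap f (λ a → u a + v a))
          ≈⟨ +-cong (ap-+ g u v) (-‿cong (trans (*-cong refl (ap-+ f u v)) (distribˡ μ _ _))) ⟩
        (ap g u + ap g v) + - (μ * ap f u + μ * ap f v)
          ≈⟨ +-cong refl (sym (-‿+-comm _ _)) ⟩
        (ap g u + ap g v) + (- (μ * ap f u) + - (μ * ap f v))
          ≈⟨ interchange _ _ _ _ ⟩
        (ap g u + - (μ * ap f u)) + (ap g v + - (μ * ap f v)) ∎
    ; ap-* = λ c u → begin
        ap g (λ a → c * u a) + - (μ * ap f (λ a → c * u a))
          ≈⟨ +-cong (ap-* g c u) (-‿cong (trans (*-cong refl (ap-* f c u)) (*-exchange μ c _))) ⟩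
        c * ap g u + - (c * (μ * ap f u))
          ≈⟨ +-cong refl (-‿distribʳ-* c _) ⟩
        c * ap g u + c * - (μ * ap f u)
          ≈⟨ sym (distribˡ c _ _) ⟩
        c * (ap g u + - (μ * ap f u)) ∎ }

  open IsSubspace
  open HasDim

  zeros-sub : ∀ {A I : Set} (P : I → Set) (g : I → LinearForm A) → IsSubspace F (λ v → ∀ i → P i → ap (g i) v ≈ 0#)
  zeros-sub P g = record
    { resp  = λ u≐v u∈ i i∈ → trans (sym (resp (g i) u≐v)) (u∈ i i∈)
    ; zero∈ = λ i _ → ap-zero (g i)
    ; +∈    = λ u∈ v∈ i i∈ → trans (ap-+ (g i) _ _) (trans (+-cong (u∈ i i∈) (v∈ i i∈)) (+-identityʳ 0#))
    ; ·∈    = λ c u∈ i i∈ → trans (ap-* (g i) c _) (trans (*-cong refl (u∈ i i∈)) (zeroʳ c)) }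

  lc∈ : ∀ {A} {V : Pred A} → IsSubspace F V → ∀ d c (b : Fin d → A → Carrier) → (∀ k → V (b k)) → V (lc d c b)
  lc∈ V-sub nzero    c b b∈ = zero∈ V-sub
  lc∈ V-sub (nsuc d) c b b∈ =
    +∈ V-sub (·∈ V-sub (c zero) (b∈ zero)) (lc∈ V-sub d (λ k → c (suc k)) (λ k → b (suc k)) (λ k → b∈ (suc k)))

  lc-cong : ∀ {A} d {c c' : Fin d → Carrier} (b : Fin d → A → Carrier) → (∀ k → c k ≈ c' k) → lc d c b ≐ lc d c' b
  lc-cong d b c≈c' a = sum-cong d (λ k → *-cong (c≈c' k) refl)

  HasDim-transport : ∀ {A} {V V' : Pred A} {d} → (∀ v → V v → V' v) → (∀ v → V' v → V v) → HasDim F V d → HasDim F V' d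
  HasDim-transport V⊆V' V'⊆V h = record
    { basis = basis h ; basis∈ = λ k → V⊆V' _ (basis∈ h k)
    ; indep = indep h ; spanning = λ v v∈ → spanning h v (V'⊆V v v∈) }

  -- The zero space has dimension 0: a basis vector would give 1 ≈ 0.
  dim-trivial : ∀ {A} {V : Pred A} {d} → HasDim F V d → (∀ v → V v → v ≐ (λ _ → 0#)) → d ≡ 0
  dim-trivial {d = nzero}  h V≐0 = P.refl
  dim-trivial {d = nsuc d} h V≐0 = ⊥-elim (0≉1 (sym (indep h (λ _ → 1#) all-zero zero)))
    where
    all-zero : lc (nsuc d) (λ _ → 1#) (basis h) ≐ (λ _ → 0#)
    all-zero a = sum-zero (nsuc d) {λ k → 1# * basis h k a} (λ k → trans (*-cong refl (V≐0 (basis h k) (basis∈ h k) a)) (zeroʳ _))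

  vanish-on-span : ∀ {A} {V : Pred A} {d} (h : HasDim F V d) (g : LinearForm A) →
    (∀ k → ap g (basis h k) ≈ 0#) → ∀ v → V v → ap g v ≈ 0#
  vanish-on-span {d = d} h g g≈0 v v∈ = begin
    ap g v                                 ≈⟨ resp g (proj₂ coords) ⟩
    ap g (lc d (proj₁ coords) (basis h))   ≈⟨ ap-lc g d (proj₁ coords) (basis h) ⟩
    sum d (λ k → _ * ap g (basis h k))     ≈⟨ sum-zero d (λ k → trans (*-cong refl (g≈0 k)) (zeroʳ _)) ⟩
    0#                                     ∎
    where coords = spanning h v v∈

  coords-unique : ∀ {A} {V : Pred A} {d} (h : HasDim F V d) (x y : Fin d → Carrier) →
    lc d x (basis h) ≐ lc d y (basis h) → ∀ k → x k ≈ y k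
  coords-unique {d = d} h x y x≐y k =
    trans (+-inverseˡ-unique _ _ (indep h (λ k → x k + - y k) difference-zero k)) (-‿involutive _)
    where
    b = basis h
    difference-zero : lc d (λ k → x k + - y k) b ≐ (λ _ → 0#)
    difference-zero a = begin
      sum d (λ k → (x k + - y k) * b k a)
        ≈⟨ sum-cong d (λ k → trans (distribʳ _ _ _) (+-cong refl (sym (-‿distribˡ-* _ _)))) ⟩
      sum d (λ k → x k * b k a + - (y k * b k a))  ≈⟨ sum-+ d _ _ ⟩
      lc d x b a + sum d (λ k → - (y k * b k a))   ≈⟨ +-cong (x≐y a) (sum-neg d _) ⟩
      lc d y b a + - lc d y b a                    ≈⟨ -‿inverseʳ _ ⟩
      0#                                           ∎

  bringToFront : ∀ {A} {V : Pred A} {s} → HasDim F V (nsuc s) → Fin (nsuc s) → HasDim F V (nsuc s)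
  bringToFront {s = s} h p = record
    { basis    = λ k → basis h (σ k)
    ; basis∈   = λ k → basis∈ h (σ k)
    ; indep    = λ c c≐0 k → trans (sym (unpermute-σ c k (σ k Fin.≟ p))) (indep h (unpermuted c) (reindex c c≐0) (σ k))
    ; spanning = λ v v∈ → let (c , v≐) = spanning h v v∈ in
        (λ k → c (σ k)) , (λ a → trans (v≐ a) (sum-punchIn s (λ k → c k * basis h k a) p))
    }
    where
    σ : Fin (nsuc s) → Fin (nsuc s)
    σ = p ∷ punchIn p

    unpermute : (c : Fin (nsuc s) → Carrier) (k : Fin (nsuc s)) → Dec (k ≡ p) → Carrier
    unpermute c k (yes _)  = c zero
    unpermute c k (no k≢p) = c (suc (punchOut {i = p} {j = k} (λ p≡k → k≢p (P.sym p≡k))))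

    unpermuted : (Fin (nsuc s) → Carrier) → Fin (nsuc s) → Carrier
    unpermuted c k = unpermute c k (k Fin.≟ p)

    unpermute-σ : ∀ c k (d : Dec (σ k ≡ p)) → unpermute c (σ k) d ≈ c k
    unpermute-σ c zero    (yes _)  = refl
    unpermute-σ c zero    (no p≢p) = ⊥-elim (p≢p P.refl)
    unpermute-σ c (suc q) (yes e)  = ⊥-elim (punchInᵢ≢i p q e)
    unpermute-σ c (suc q) (no _)   =
      reflexive (P.cong (λ z → c (suc z)) (P.trans (punchOut-cong p P.refl) (punchOut-punchIn p)))

    reindex : ∀ c → lc (nsuc s) c (λ k → basis h (σ k)) ≐ (λ _ → 0#) → lc (nsuc s) (unpermuted c) (basis h) ≐ (λ _ → 0#)
    reindex c c≐0 a = begin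
      lc (nsuc s) (unpermuted c) (basis h) a
        ≈⟨ sum-punchIn s (λ k → unpermuted c k * basis h k a) p ⟩
      lc (nsuc s) (λ k → unpermuted c (σ k)) (λ k → basis h (σ k)) a
        ≈⟨ lc-cong (nsuc s) (λ k → basis h (σ k)) (λ k → unpermute-σ c k (σ k Fin.≟ p)) a ⟩
      lc (nsuc s) c (λ k → basis h (σ k)) a
        ≈⟨ c≐0 a ⟩
      0# ∎

-- Gaussian elimination for finitely many linear forms on a finite-dimensional
-- subspace.  Deciding whether a scalar is zero is needed to choose pivots.
module Elimination (F : Field) (decZero : ∀ x → Dec (Field._≈_ F x (Field.0# F))) where
  open Field F hiding (zero)
  open LinearAlgebra F
  open import Relation.Binary.Reasoning.Setoid setoid
  open RingProperties ring using (-‿distribˡ-*; -‿distribʳ-*; -‿involutive; +-inverseˡ-unique; -0#≈0#; -1*x≈-x)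
  open HasDim
  open IsSubspace

  Kernel : ∀ {A} → Pred A → ∀ {r} → (Fin r → LinearForm A) → Pred A
  Kernel W f v = W v × (∀ i → ap (f i) v ≈ 0#)

  Relations : ∀ {A} → Pred A → ∀ r → (Fin r → LinearForm A) → Pred (Fin r)
  Relations W r f a = ∀ w → W w → combination r a f w ≈ 0#

  SpanAnnihilator : ∀ {A} → Pred A → ∀ r → (Fin r → LinearForm A) → Set
  SpanAnnihilator {A} W r f = ∀ (g : LinearForm A) → (∀ v → Kernel W f v → ap g v ≈ 0#) →
    Σ (Fin r → Carrier) λ a → ∀ w → W w → ap g w ≈ combination r a f w

  record Eliminated {A} (W : Pred A) (k r : ℕ) (f : Fin r → LinearForm A) : Set where
    field
      rank nullity corank : ℕ
      nullity+rank : nullity ℕ.+ rank ≡ k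
      corank+rank  : corank ℕ.+ rank ≡ r
      kernel       : HasDim F (Kernel W f) nullity
      relations    : HasDim F (Relations W r f) corank
      annihilator  : SpanAnnihilator W r f

  eliminate-none : ∀ {A} {W : Pred A} {k} → HasDim F W k → (f : Fin 0 → LinearForm A) → Eliminated W k 0 f
  eliminate-none {k = k} hW f = record
    { rank = 0 ; nullity = k ; corank = 0 ; nullity+rank = ℕP.+-identityʳ k ; corank+rank = P.refl
    ; kernel      = HasDim-transport (λ v v∈ → v∈ , λ ()) (λ v → proj₁) hW
    ; relations   = record { basis = λ () ; basis∈ = λ () ; indep = λ c _ () ; spanning = λ a _ → (λ ()) , (λ ()) }
    ; annihilator = λ g g≈0 → (λ ()) , (λ w w∈ → g≈0 w (w∈ , λ ())) }

  -- Adding a form f₀ that vanishes on the common kernel of the others: the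
  -- kernel and rank are unchanged and f₀ − Σ βᵢ fᵢ is one new relation.
  module AddDependent {A} {W : Pred A} {k r} (f : Fin (nsuc r) → LinearForm A)
                      (R : Eliminated W k r (λ i → f (suc i)))
                      (f₀-on-kernel : ∀ v → Kernel W (λ i → f (suc i)) v → ap (f zero) v ≈ 0#) where
    open Eliminated R
    f₀ = f zero
    fs = λ (i : Fin r) → f (suc i)

    extend-kernel : ∀ v → Kernel W fs v → Kernel W f v
    extend-kernel v (w , fs≈0) = w , λ { zero → f₀-on-kernel v (w , fs≈0) ; (suc i) → fs≈0 i }

    kernel' : HasDim F (Kernel W f) nullity
    kernel' = HasDim-transport extend-kernel (λ v (w , f≈0) → w , λ i → f≈0 (suc i)) kernel

    f₀-as-combination : Σ (Fin r → Carrier) λ β → ∀ w → W w → ap f₀ w ≈ combination r β fs w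
    f₀-as-combination = annihilator f₀ f₀-on-kernel

    β : Fin r → Carrier
    β = proj₁ f₀-as-combination

    newRelation : Fin (nsuc corank) → Fin (nsuc r) → Carrier
    newRelation zero    = - 1# ∷ β
    newRelation (suc l) = 0# ∷ basis relations l

    newRelation∈ : ∀ l → Relations W (nsuc r) f (newRelation l)
    newRelation∈ zero w w∈ = begin
      - 1# * ap f₀ w + combination r β fs w  ≈⟨ +-cong (-1*x≈-x _) (sym (proj₂ f₀-as-combination w w∈)) ⟩
      - ap f₀ w + ap f₀ w                    ≈⟨ -‿inverseˡ _ ⟩
      0#                                     ∎
    newRelation∈ (suc l) w w∈ = trans (combination-0∷ r _ f w) (basis∈ relations l w w∈)

    -- The f₀-coordinate shows the coefficient of (−1, β) is zero.
    newRelation-indep : ∀ c → lc (nsuc corank) c newRelation ≐ (λ _ → 0#) → ∀ l → c l ≈ 0#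
    newRelation-indep c c≐0 = coefficient
      where
      c₀≈0 : c zero ≈ 0#
      c₀≈0 = begin
        c zero                 ≈⟨ sym (-‿involutive _) ⟩
        - (- c zero)           ≈⟨ -‿cong (sym (trans (*-comm _ _) (-1*x≈-x _))) ⟩
        - (c zero * - 1#)      ≈⟨ -‿cong (sym (trans (+-cong refl (sum-zero corank (λ l → zeroʳ _))) (+-identityʳ _))) ⟩
        - (lc (nsuc corank) c newRelation zero)  ≈⟨ -‿cong (c≐0 zero) ⟩
        - 0#                   ≈⟨ -0#≈0# ⟩
        0#                     ∎
      rest : lc corank (λ l → c (suc l)) (basis relations) ≐ (λ _ → 0#)
      rest i = trans (sym (+-identityˡ _)) (trans (+-cong (sym (trans (*-cong c₀≈0 refl) (zeroˡ _))) refl) (c≐0 (suc i)))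
      coefficient : ∀ l → c l ≈ 0#
      coefficient zero    = c₀≈0
      coefficient (suc l) = indep relations (λ l → c (suc l)) rest l

    -- A relation a of f gives the relation (aᵢ₊₁ + a₀ βᵢ)ᵢ of the others.
    newRelation-span : ∀ a → Relations W (nsuc r) f a → Σ (Fin (nsuc corank) → Carrier) λ c → a ≐ lc (nsuc corank) c newRelation
    newRelation-span a a∈ = (- a zero ∷ proj₁ old) , coordinates
      where
      a' : Fin r → Carrier
      a' i = a (suc i) + a zero * β i
      a'∈ : Relations W r fs a'
      a'∈ w w∈ = begin
        sum r (λ i → (a (suc i) + a zero * β i) * ap (fs i) w)
          ≈⟨ sum-cong r (λ i → trans (distribʳ _ _ _) (+-cong refl (*-assoc _ _ _))) ⟩
        sum r (λ i → a (suc i) * ap (fs i) w + a zero * (β i * ap (fs i) w))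
          ≈⟨ sum-+ r _ _ ⟩
        combination r (λ i → a (suc i)) fs w + sum r (λ i → a zero * (β i * ap (fs i) w))
          ≈⟨ +-cong refl (trans (sum-*ˡ r _ _) (*-cong refl (sym (proj₂ f₀-as-combination w w∈)))) ⟩
        combination r (λ i → a (suc i)) fs w + a zero * ap f₀ w
          ≈⟨ +-comm _ _ ⟩
        combination (nsuc r) a f w
          ≈⟨ a∈ w w∈ ⟩
        0# ∎
      old = spanning relations a' a'∈
      coordinates : a ≐ lc (nsuc corank) (- a zero ∷ proj₁ old) newRelation
      coordinates zero = sym (begin
        - a zero * - 1# + sum corank (λ l → proj₁ old l * 0#)
          ≈⟨ +-cong (trans (*-comm _ _) (-1*x≈-x _)) (sum-zero corank (λ l → zeroʳ _)) ⟩
        - (- a zero) + 0#  ≈⟨ trans (+-identityʳ _) (-‿involutive _) ⟩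
        a zero             ∎)
      coordinates (suc i) = sym (begin
        - a zero * β i + lc corank (proj₁ old) (basis relations) i
          ≈⟨ +-cong refl (sym (proj₂ old i)) ⟩
        - a zero * β i + (a (suc i) + a zero * β i)
          ≈⟨ +-cong (sym (-‿distribˡ-* _ _)) (+-comm _ _) ⟩
        - (a zero * β i) + (a zero * β i + a (suc i))
          ≈⟨ sym (+-assoc _ _ _) ⟩
        (- (a zero * β i) + a zero * β i) + a (suc i)
          ≈⟨ trans (+-cong (-‿inverseˡ _) refl) (+-identityˡ _) ⟩
        a (suc i) ∎)

    relations' : HasDim F (Relations W (nsuc r) f) (nsuc corank)
    relations' = record { basis = newRelation ; basis∈ = newRelation∈ ; indep = newRelation-indep ; spanning = newRelation-span }

    annihilator' : SpanAnnihilator W (nsuc r) f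
    annihilator' g g≈0 = (0# ∷ proj₁ old) , λ w w∈ → trans (proj₂ old w w∈) (sym (combination-0∷ r _ f w))
      where old = annihilator g (λ v v∈ → g≈0 v (extend-kernel v v∈))

    result : Eliminated W k (nsuc r) f
    result = record
      { rank = rank ; nullity = nullity ; corank = nsuc corank
      ; nullity+rank = nullity+rank ; corank+rank = P.cong nsuc corank+rank
      ; kernel = kernel' ; relations = relations' ; annihilator = annihilator' }

  -- Adding a form f₀ that is nonzero on the first vector U₀ of a basis U of
  -- the common kernel of the others: the new kernel has basis
  -- V_q = U_{q+1} − (f₀(U_{q+1})/f₀(U₀)) U₀, the relations are unchanged and
  -- the rank grows by one.
  module AddIndependent {A} {W : Pred A} {k r} (f : Fin (nsuc r) → LinearForm A)
                        (W-sub : IsSubspace F W) (R : Eliminated W k r (λ i → f (suc i)))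
                        {s} (U-basis : HasDim F (Kernel W (λ i → f (suc i))) (nsuc s))
                        (s+rank : nsuc s ℕ.+ Eliminated.rank R ≡ k)
                        (pivot≉0 : ¬ (ap (f zero) (basis U-basis zero) ≈ 0#)) where
    open Eliminated R hiding (kernel; nullity; nullity+rank)
    f₀ = f zero
    fs = λ (i : Fin r) → f (suc i)
    U = basis U-basis

    π : Carrier
    π = ap f₀ (U zero)

    π⁻¹ : Carrier
    π⁻¹ = proj₁ (inverse π pivot≉0)

    ππ⁻¹≈1 : π * π⁻¹ ≈ 1#
    ππ⁻¹≈1 = proj₂ (inverse π pivot≉0)

    cancel-π : ∀ a → a ≈ (a * π) * π⁻¹
    cancel-π a = trans (sym (*-identityʳ a)) (trans (*-cong refl (sym ππ⁻¹≈1)) (sym (*-assoc _ _ _)))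

    x-x/π·π≈0 : ∀ x → x + (- (x * π⁻¹)) * π ≈ 0#
    x-x/π·π≈0 x = begin
      x + (- (x * π⁻¹)) * π  ≈⟨ +-cong refl (sym (-‿distribˡ-* _ _)) ⟩
      x + - ((x * π⁻¹) * π)  ≈⟨ +-cong refl (-‿cong (trans (*-assoc _ _ _) (trans (*-cong refl (trans (*-comm _ _) ππ⁻¹≈1)) (*-identityʳ x)))) ⟩
      x + - x                ≈⟨ -‿inverseʳ x ⟩
      0#                     ∎

    U∈W : ∀ k → W (U k)
    U∈W k = proj₁ (basis∈ U-basis k)

    fs-kills-U : ∀ k i → ap (fs i) (U k) ≈ 0#
    fs-kills-U k = proj₂ (basis∈ U-basis k)

    ratio : Fin s → Carrier
    ratio q = ap f₀ (U (suc q)) * π⁻¹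

    V : Fin s → A → Carrier
    V q a = U (suc q) a + (- ratio q) * U zero a

    V∈ : ∀ q → Kernel W f (V q)
    V∈ q = +∈ W-sub (U∈W (suc q)) (·∈ W-sub (- ratio q) (U∈W zero)) , killed
      where
      killed : ∀ i → ap (f i) (V q) ≈ 0#
      killed zero    = trans (ap-axpy f₀ _ _ _) (x-x/π·π≈0 (ap f₀ (U (suc q))))
      killed (suc i) = trans (ap-axpy (fs i) _ _ _)
        (trans (+-cong (fs-kills-U (suc q) i) (trans (*-cong refl (fs-kills-U zero i)) (zeroʳ _))) (+-identityʳ 0#))

    V-as-U : ∀ c a → lc s c V a ≈ lc (nsuc s) (sum s (λ q → c q * - ratio q) ∷ c) U a
    V-as-U c a = begin
      sum s (λ q → c q * (U (suc q) a + (- ratio q) * U zero a))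
        ≈⟨ sum-cong s (λ q → trans (distribˡ _ _ _) (+-cong refl (sym (*-assoc _ _ _)))) ⟩
      sum s (λ q → c q * U (suc q) a + (c q * - ratio q) * U zero a)
        ≈⟨ sum-+ s _ _ ⟩
      lc s c (λ q → U (suc q)) a + sum s (λ q → (c q * - ratio q) * U zero a)
        ≈⟨ +-cong refl (sum-*ʳ s _ _) ⟩
      lc s c (λ q → U (suc q)) a + sum s (λ q → c q * - ratio q) * U zero a
        ≈⟨ +-comm _ _ ⟩
      lc (nsuc s) (sum s (λ q → c q * - ratio q) ∷ c) U a ∎

    V-indep : ∀ c → lc s c V ≐ (λ _ → 0#) → ∀ q → c q ≈ 0#
    V-indep c c≐0 q = indep U-basis (_ ∷ c) (λ a → trans (sym (V-as-U c a)) (c≐0 a)) (suc q)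

    first-coordinate : ∀ (c : Fin (nsuc s) → Carrier) → ap f₀ (lc (nsuc s) c U) ≈ 0# →
      c zero ≈ sum s (λ q → c (suc q) * - ratio q)
    first-coordinate c f₀≈0 = begin
      c zero               ≈⟨ cancel-π _ ⟩
      (c zero * π) * π⁻¹   ≈⟨ *-cong (+-inverseˡ-unique _ _ (trans (sym (ap-lc f₀ (nsuc s) c U)) f₀≈0)) refl ⟩
      (- S) * π⁻¹          ≈⟨ sym (-‿distribˡ-* _ _) ⟩
      - (S * π⁻¹)          ≈⟨ -‿cong (sym (sum-*ʳ s _ _)) ⟩
      - sum s (λ q → (c (suc q) * ap f₀ (U (suc q))) * π⁻¹)  ≈⟨ sym (sum-neg s _) ⟩
      sum s (λ q → - ((c (suc q) * ap f₀ (U (suc q))) * π⁻¹))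
        ≈⟨ sum-cong s (λ q → trans (-‿cong (*-assoc _ _ _)) (-‿distribʳ-* _ _)) ⟩
      sum s (λ q → c (suc q) * - ratio q) ∎
      where S = sum s (λ q → c (suc q) * ap f₀ (U (suc q)))

    V-span : ∀ v → Kernel W f v → Σ (Fin s → Carrier) λ c → v ≐ lc s c V
    V-span v (w , f≈0) = (λ q → c (suc q)) , λ a → begin
      v a                 ≈⟨ proj₂ coords a ⟩
      lc (nsuc s) c U a   ≈⟨ lc-cong (nsuc s) U c≈ a ⟩
      lc (nsuc s) (_ ∷ (λ q → c (suc q))) U a  ≈⟨ sym (V-as-U _ a) ⟩
      lc s (λ q → c (suc q)) V a ∎
      where
      coords = spanning U-basis v (w , λ i → f≈0 (suc i))
      c = proj₁ coords
      c≈ : ∀ k → c k ≈ (sum s (λ q → c (suc q) * - ratio q) ∷ (λ q → c (suc q))) k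
      c≈ zero    = first-coordinate c (trans (sym (resp f₀ (proj₂ coords))) (f≈0 zero))
      c≈ (suc k) = refl

    kernel' : HasDim F (Kernel W f) s
    kernel' = record { basis = V ; basis∈ = V∈ ; indep = V-indep ; spanning = V-span }

    -- Evaluating a relation at U₀ shows that its f₀-coefficient vanishes.
    relation-head≈0 : ∀ a → Relations W (nsuc r) f a → a zero ≈ 0#
    relation-head≈0 a a∈ = begin
      a zero                                ≈⟨ cancel-π _ ⟩
      (a zero * π) * π⁻¹                    ≈⟨ *-cong (trans (sym (+-identityʳ _)) (+-cong refl (sym tail≈0))) refl ⟩
      combination (nsuc r) a f (U zero) * π⁻¹  ≈⟨ *-cong (a∈ (U zero) (U∈W zero)) refl ⟩
      0# * π⁻¹                              ≈⟨ zeroˡ _ ⟩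
      0#                                    ∎
      where
      tail≈0 : combination r (λ i → a (suc i)) fs (U zero) ≈ 0#
      tail≈0 = sum-zero r (λ i → trans (*-cong refl (fs-kills-U zero i)) (zeroʳ _))

    relations' : HasDim F (Relations W (nsuc r) f) corank
    relations' = record
      { basis    = λ l → 0# ∷ basis relations l
      ; basis∈   = λ l w w∈ → trans (combination-0∷ r _ f w) (basis∈ relations l w w∈)
      ; indep    = λ c c≐0 → indep relations c (λ i → c≐0 (suc i))
      ; spanning = λ a a∈ → let old = spanning relations (λ i → a (suc i)) (tail∈ a a∈) in
          proj₁ old , λ { zero → trans (relation-head≈0 a a∈) (sym (sum-zero corank (λ l → zeroʳ _)))
                        ; (suc i) → proj₂ old i } }
      where
      tail∈ : ∀ a → Relations W (nsuc r) f a → Relations W r fs (λ i → a (suc i))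
      tail∈ a a∈ w w∈ = trans (sym (+-identityˡ _))
        (trans (+-cong (sym (trans (*-cong (relation-head≈0 a a∈) refl) (zeroˡ _))) refl) (a∈ w w∈))

    -- If g vanishes on the new kernel, then h = g − (g(U₀)/π) f₀ vanishes on the old one.
    annihilator' : SpanAnnihilator W (nsuc r) f
    annihilator' g g≈0 = (μ ∷ proj₁ old) , λ w w∈ → g≈μf₀+rest (proj₂ old w w∈)
      where
      μ = ap g (U zero) * π⁻¹
      h = subtractMultiple g μ f₀
      h-kills-V : ∀ q → ap h (V q) ≈ 0#
      h-kills-V q = trans (+-cong (g≈0 (V q) (V∈ q)) (-‿cong (trans (*-cong refl (proj₂ (V∈ q) zero)) (zeroʳ _))))
                          (trans (+-identityˡ _) -0#≈0#)
      h-kills-U₀ : ap h (U zero) ≈ 0#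
      h-kills-U₀ = trans (+-cong refl (-‿distribˡ-* _ _)) (x-x/π·π≈0 (ap g (U zero)))
      U-via-V : ∀ q → U (suc q) ≐ (λ a → V q a + ratio q * U zero a)
      U-via-V q a = begin
        U (suc q) a                                          ≈⟨ sym (+-identityʳ _) ⟩
        U (suc q) a + 0#                                     ≈⟨ +-cong refl (sym (trans (sym (distribʳ _ _ _)) (trans (*-cong (-‿inverseˡ _) refl) (zeroˡ _)))) ⟩
        U (suc q) a + ((- ratio q) * U zero a + ratio q * U zero a) ≈⟨ sym (+-assoc _ _ _) ⟩
        V q a + ratio q * U zero a                              ∎
      h-kills-U : ∀ k → ap h (U k) ≈ 0#
      h-kills-U zero    = h-kills-U₀
      h-kills-U (suc q) = trans (resp h (U-via-V q))
        (trans (ap-axpy h _ _ _) (trans (+-cong (h-kills-V q) (trans (*-cong refl h-kills-U₀) (zeroʳ _))) (+-identityʳ 0#)))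
      old = annihilator h (vanish-on-span U-basis h h-kills-U)
      g≈μf₀+rest : ∀ {w} {x} → ap g w + - (μ * ap f₀ w) ≈ x → ap g w ≈ μ * ap f₀ w + x
      g≈μf₀+rest {w} {x} e = begin
        ap g w                                        ≈⟨ sym (+-identityʳ _) ⟩
        ap g w + 0#                                   ≈⟨ +-cong refl (sym (-‿inverseˡ _)) ⟩
        ap g w + (- (μ * ap f₀ w) + μ * ap f₀ w)      ≈⟨ sym (+-assoc _ _ _) ⟩
        (ap g w + - (μ * ap f₀ w)) + μ * ap f₀ w      ≈⟨ +-cong e refl ⟩
        x + μ * ap f₀ w                               ≈⟨ +-comm _ _ ⟩
        μ * ap f₀ w + x                               ∎

    result : Eliminated W k (nsuc r) f
    result = record
      { rank = nsuc rank ; nullity = s ; corank = corank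
      ; nullity+rank = P.trans (ℕP.+-suc s rank) s+rank
      ; corank+rank  = P.trans (ℕP.+-suc corank rank) (P.cong nsuc corank+rank)
      ; kernel = kernel' ; relations = relations' ; annihilator = annihilator' }

  find-nonzero : ∀ s (x : Fin s → Carrier) → (Σ (Fin s) λ p → ¬ x p ≈ 0#) ⊎ (∀ p → x p ≈ 0#)
  find-nonzero nzero    x = inj₂ (λ ())
  find-nonzero (nsuc s) x with decZero (x zero) | find-nonzero s (λ i → x (suc i))
  ... | no x₀≉0  | _              = inj₁ (zero , x₀≉0)
  ... | yes _    | inj₁ (p , x≉0) = inj₁ (suc p , x≉0)
  ... | yes x₀≈0 | inj₂ rest≈0    = inj₂ (λ { zero → x₀≈0 ; (suc i) → rest≈0 i })

  eliminate-step : ∀ {A} {W : Pred A} {k r} → IsSubspace F W → (f : Fin (nsuc r) → LinearForm A) →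
    Eliminated W k r (λ i → f (suc i)) → Eliminated W k (nsuc r) f
  eliminate-step {W = W} {k} W-sub f R =
    case-pivot (nullity R) (kernel R) (nullity+rank R) (find-nonzero _ λ p → ap (f zero) (basis (kernel R) p))
    where
    open Eliminated
    case-pivot : ∀ s (K : HasDim F (Kernel W (λ i → f (suc i))) s) → s ℕ.+ rank R ≡ k →
      (Σ (Fin s) λ p → ¬ ap (f zero) (basis K p) ≈ 0#) ⊎ (∀ p → ap (f zero) (basis K p) ≈ 0#) →
      Eliminated W k _ f
    case-pivot (nsuc s) K s+rank (inj₁ (p , pivot≉0)) =
      AddIndependent.result f W-sub R (bringToFront K p) s+rank pivot≉0
    case-pivot nzero K _ (inj₁ (() , _))
    case-pivot s K _ (inj₂ f₀-kills-basis) = AddDependent.result f R (vanish-on-span K (f zero) f₀-kills-basis)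

  eliminate : ∀ {A} {W : Pred A} {k} → IsSubspace F W → HasDim F W k → ∀ r (f : Fin r → LinearForm A) → Eliminated W k r f
  eliminate W-sub hW nzero    f = eliminate-none hW f
  eliminate W-sub hW (nsuc r) f = eliminate-step W-sub f (eliminate W-sub hW r (λ i → f (suc i)))

module StandardPairing (F : Field) (decZero : ∀ x → Dec (Field._≈_ F x (Field.0# F)))
                       {A : Set} {N : ℕ} (enum : Fin N ↔ A) where
  open Field F hiding (zero)
  open LinearAlgebra F
  open Elimination F decZero
  open import Relation.Binary.Reasoning.Setoid setoid
  open Inverse enum using (to; from; strictlyInverseˡ; strictlyInverseʳ)
  open HasDim

  ⟨_,_⟩ : (A → Carrier) → (A → Carrier) → Carrier
  ⟨ x , y ⟩ = sum N (λ K → x (to K) * y (to K))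

  ⟨⟩-comm : ∀ x y → ⟨ x , y ⟩ ≈ ⟨ y , x ⟩
  ⟨⟩-comm x y = sum-cong N (λ K → *-comm _ _)

  pairWith : (A → Carrier) → LinearForm A
  pairWith y = record
    { ap   = λ v → ⟨ v , y ⟩
    ; resp = λ u≐v → sum-cong N (λ K → *-cong (u≐v (to K)) refl)
    ; ap-+ = λ u v → trans (sum-cong N (λ K → distribʳ _ _ _)) (sum-+ N _ _)
    ; ap-* = λ c u → trans (sum-cong N (λ K → *-assoc _ _ _)) (sum-*ˡ N c _) }

  unit : Fin N → A → Carrier
  unit K a = δ K (from a)

  ⟨⟩-unit : ∀ x K → ⟨ x , unit K ⟩ ≈ x (to K)
  ⟨⟩-unit x K = begin
    sum N (λ L → x (to L) * δ K (from (to L)))  ≈⟨ sum-cong N (λ L → *-cong refl (trans (reflexive (P.cong (δ K) (strictlyInverseʳ L))) (δ-sym K L))) ⟩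
    sum N (λ L → x (to L) * δ L K)              ≈⟨ sum-δ N (λ L → x (to L)) K ⟩
    x (to K)                                    ∎

  ⟨unit⟩ : ∀ x K → ⟨ unit K , x ⟩ ≈ x (to K)
  ⟨unit⟩ x K = trans (⟨⟩-comm (unit K) x) (⟨⟩-unit x K)

  everything : Pred A
  everything _ = ⊤

  everything-sub : IsSubspace F everything
  everything-sub = record { resp = λ _ _ → tt ; zero∈ = tt ; +∈ = λ _ _ → tt ; ·∈ = λ _ _ → tt }

  unit-expansion : ∀ (x : A → Carrier) → x ≐ lc N (λ K → x (to K)) unit
  unit-expansion x a = sym (trans (sum-δ N (λ K → x (to K)) (from a)) (reflexive (P.cong x (strictlyInverseˡ a))))

  standardBasis : HasDim F everything N
  standardBasis = record
    { basis    = unit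
    ; basis∈   = λ _ → tt
    ; indep    = λ c c≐0 K → trans (sym (lc-unit c K)) (c≐0 (to K))
    ; spanning = λ x _ → (λ K → x (to K)) , unit-expansion x }
    where
    lc-unit : ∀ c K → lc N c unit (to K) ≈ c K
    lc-unit c K = trans (sum-cong N (λ L → *-cong refl (reflexive (P.cong (δ L) (strictlyInverseʳ K))))) (sum-δ N c K)

  -- V⊥⊥ ⊆ V for every finite-dimensional subspace V of F^A: x is recovered
  -- from the values ⟨ unit_K , x ⟩, which are combinations of those of V's basis.
  perp-perp-⊆ : ∀ {V : Pred A} {d} → IsSubspace F V → HasDim F V d →
    ∀ x → (∀ y → (∀ v → V v → ⟨ v , y ⟩ ≈ 0#) → ⟨ x , y ⟩ ≈ 0#) → V x
  perp-perp-⊆ {V} {d} V-sub hV x x∈V⊥⊥ = IsSubspace.resp V-sub (λ a → sym (x≐ a)) (lc∈ V-sub d coeffs b (basis∈ hV))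
    where
    b = basis hV
    R = eliminate everything-sub standardBasis d (λ k → pairWith (b k))
    x-on-kernel : ∀ v → Kernel everything (λ k → pairWith (b k)) v → ⟨ v , x ⟩ ≈ 0#
    x-on-kernel v (_ , v⊥b) = trans (⟨⟩-comm v x)
      (x∈V⊥⊥ v (vanish-on-span hV (pairWith v) (λ k → trans (⟨⟩-comm (b k) v) (v⊥b k))))
    represented = Eliminated.annihilator R (pairWith x) x-on-kernel
    coeffs = proj₁ represented
    x≐ : x ≐ lc d coeffs b
    x≐ a = begin
      x a                                           ≡⟨ P.cong x (strictlyInverseˡ a) ⟨
      x (to (from a))                               ≈⟨ sym (⟨unit⟩ x (from a)) ⟩
      ⟨ unit (from a) , x ⟩                         ≈⟨ proj₂ represented (unit (from a)) tt ⟩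
      sum d (λ k → coeffs k * ⟨ unit (from a) , b k ⟩)  ≈⟨ sum-cong d (λ k → *-cong refl (⟨unit⟩ (b k) (from a))) ⟩
      lc d coeffs b (to (from a))                   ≡⟨ P.cong (lc d coeffs b) (strictlyInverseˡ a) ⟩
      lc d coeffs b a                               ∎

module Dimension (F : Field) (decZero : ∀ x → Dec (Field._≈_ F x (Field.0# F))) where
  open Field F hiding (zero)
  open LinearAlgebra F
  open Elimination F decZero
  open import Relation.Binary.Reasoning.Setoid setoid
  open HasDim

  -- Write the a vectors of the first basis in the b vectors of the second and
  -- eliminate the a coordinate forms on F^b: they have no relations, because
  -- the first basis is independent, so a = rank ≤ b.
  dim-≤ : ∀ {A} {V : Pred A} {a b} → HasDim F V a → HasDim F V b → a ℕ.≤ b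
  dim-≤ {A} {V} {a} {b} h₁ h₂ =
    P.subst (a ℕ.≤_) nullity+rank (P.subst (ℕ._≤ nullity ℕ.+ rank) rank≡a (ℕP.m≤n+m rank nullity))
    where
    open StandardPairing F decZero (↔-id (Fin b))
    y : Fin a → Fin b → Carrier
    y i = proj₁ (spanning h₂ (basis h₁ i) (basis∈ h₁ i))
    y-coords : ∀ i → basis h₁ i ≐ lc b (y i) (basis h₂)
    y-coords i = proj₂ (spanning h₂ (basis h₁ i) (basis∈ h₁ i))
    open Eliminated (eliminate everything-sub standardBasis a (λ i → pairWith (y i)))
    no-relations : ∀ α → Relations everything a (λ i → pairWith (y i)) α → α ≐ (λ _ → 0#)
    no-relations α α∈ = indep h₁ α combination-zero
      where
      column-zero : ∀ j → sum a (λ i → α i * y i j) ≈ 0#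
      column-zero j = trans (sum-cong a (λ i → *-cong refl (sym (⟨unit⟩ (y i) j)))) (α∈ (unit j) tt)
      combination-zero : lc a α (basis h₁) ≐ (λ _ → 0#)
      combination-zero x = begin
        sum a (λ i → α i * basis h₁ i x)                  ≈⟨ sum-cong a (λ i → *-cong refl (y-coords i x)) ⟩
        sum a (λ i → α i * lc b (y i) (basis h₂) x)       ≈⟨ lc-lc a b α y (basis h₂) x ⟩
        lc b (λ j → sum a (λ i → α i * y i j)) (basis h₂) x  ≈⟨ sum-zero b (λ j → trans (*-cong (column-zero j) refl) (zeroˡ _)) ⟩
        0#                                                ∎
    rank≡a : rank ≡ a
    rank≡a = P.subst (λ u → u ℕ.+ rank ≡ a) (dim-trivial relations no-relations) corank+rank

  dim-unique : ∀ {A} {V : Pred A} {a b} → HasDim F V a → HasDim F V b → a ≡ b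
  dim-unique h₁ h₂ = ℕP.≤-antisym (dim-≤ h₁ h₂) (dim-≤ h₂ h₁)

module DualityCount (F : Field) (decZero : ∀ x → Dec (Field._≈_ F x (Field.0# F))) (n m : ℕ)
    (C : Mat F n m → Set) (C-sub : IsSubspace F C) (J : Vecⁿ F n → Set) (J-sub : IsSubspace F J)
    {dC dC⊥ dJ dC[J⊥⊥] dC⊥[J⊥] : ℕ}
    (hC : HasDim F C dC) (hC⊥ : HasDim F (dualCode F n m C) dC⊥) (hJ : HasDim F J dJ)
    (hC[J⊥⊥] : HasDim F (restrict F C (perp F n (perp F n J))) dC[J⊥⊥])
    (hC⊥[J⊥] : HasDim F (restrict F (dualCode F n m C) (perp F n J)) dC⊥[J⊥]) where
  open Field F hiding (zero)
  open LinearAlgebra F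
  open Elimination F decZero
  open Dimension F decZero
  open import Relation.Binary.Reasoning.Setoid setoid
  open HasDim
  module Vec = StandardPairing F decZero (↔-id (Fin n))
  module Matrix = StandardPairing F decZero (*↔× {n} {m})

  tr : Mat F n m → Mat F n m → Carrier
  tr = trMNᵀ F n m

  tr-comm : ∀ M N → tr M N ≈ tr N M
  tr-comm M N = sum-cong n (λ i → sum-cong m (λ j → *-comm _ _))

  tr-congˡ : ∀ {M M'} N → M ≐ M' → tr M N ≈ tr M' N
  tr-congˡ N M≐M' = sum-cong n (λ i → sum-cong m (λ j → *-cong (M≐M' (i , j)) refl))

  tr≈⟨⟩ : ∀ M N → tr M N ≈ Matrix.⟨ M , N ⟩
  tr≈⟨⟩ M N = sym (trans (sum-combine n m _)
    (sum-cong n (λ i → sum-cong m (λ j → reflexive (P.cong (λ ij → M ij * N ij) (remQuot-combine i j))))))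

  traceWith : Mat F n m → LinearForm (Fin n × Fin m)
  traceWith M = reshape (Matrix.pairWith M) (tr M) (λ N → trans (tr≈⟨⟩ M N) (Matrix.⟨⟩-comm M N))

  C⊥-sub : IsSubspace F (dualCode F n m C)
  C⊥-sub = zeros-sub C traceWith

  C⊥⊥⊆C : ∀ X → dualCode F n m (dualCode F n m C) X → C X
  C⊥⊥⊆C X X∈C⊥⊥ = Matrix.perp-perp-⊆ C-sub hC X λ Y Y⊥C →
    trans (Matrix.⟨⟩-comm X Y) (trans (sym (tr≈⟨⟩ Y X)) (X∈C⊥⊥ Y (λ M M∈ → trans (tr≈⟨⟩ M Y) (Y⊥C M M∈))))

  J⊥⊥⊆J : ∀ x → perp F n (perp F n J) x → J x
  J⊥⊥⊆J x x∈J⊥⊥ = Vec.perp-perp-⊆ J-sub hJ x λ y y⊥J →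
    x∈J⊥⊥ y (λ z z∈ → trans (Vec.⟨⟩-comm y z) (y⊥J z z∈))

  J⊆J⊥⊥ : ∀ x → J x → perp F n (perp F n J) x
  J⊆J⊥⊥ x x∈ y y∈J⊥ = trans (Vec.⟨⟩-comm x y) (y∈J⊥ x x∈)

  -- C(E⊥) = 0: a column orthogonal to every unit vector is zero.
  C[E⊥]-zero : ∀ M → restrict F C (perp F n (wholeSpace F n)) M → M ≐ (λ _ → 0#)
  C[E⊥]-zero M (_ , columns⊥E) (i , j) = trans (sym (Vec.⟨⟩-unit (column F M j) i)) (columns⊥E j (Vec.unit i) tt)

  b : Fin dJ → Vecⁿ F n
  b = basis hJ

  columnTest : Fin m × Fin dJ → LinearForm (Fin n × Fin m)
  columnTest jk = record
    { ap   = λ N → Vec.⟨ column F N (proj₁ jk) , b (proj₂ jk) ⟩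
    ; resp = λ N≐N' → resp g (λ i → N≐N' (i , proj₁ jk))
    ; ap-+ = λ u v → ap-+ g _ _
    ; ap-* = λ c u → ap-* g c _ }
    where g = Vec.pairWith (b (proj₂ jk))

  forms : Fin (m ℕ.* dJ) → LinearForm (Fin n × Fin m)
  forms p = columnTest (remQuot {m} dJ p)

  open Eliminated (eliminate C⊥-sub hC⊥ (m ℕ.* dJ) forms) public

  kernel≡C⊥[J⊥] : HasDim F (restrict F (dualCode F n m C) (perp F n J)) nullity
  kernel≡C⊥[J⊥] = HasDim-transport columns⊥J (λ N (N∈ , cols) → N∈ , λ p → cols _ (b _) (basis∈ hJ _)) kernel
    where
    columns⊥J : ∀ N → Kernel (dualCode F n m C) forms N → restrict F (dualCode F n m C) (perp F n J) N
    columns⊥J N (N∈ , tests≈0) = N∈ , λ j y y∈ → trans (Vec.⟨⟩-comm _ y)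
      (vanish-on-span hJ (Vec.pairWith (column F N j))
        (λ k → trans (Vec.⟨⟩-comm (b k) _) (trans (reflexive (P.cong (λ jk → ap (columnTest jk) N) (P.sym (remQuot-combine j k))))
                                                 (tests≈0 (combine j k))))
        y y∈)

  matrixOf : (Fin m → Fin dJ → Carrier) → Mat F n m
  matrixOf γ (i , j) = lc dJ (γ j) b i

  flatten : (Fin m → Fin dJ → Carrier) → Fin (m ℕ.* dJ) → Carrier
  flatten γ p = γ (proj₁ (remQuot {m} dJ p)) (proj₂ (remQuot {m} dJ p))

  combination≈tr : ∀ γ N → combination (m ℕ.* dJ) (flatten γ) forms N ≈ tr (matrixOf γ) N
  combination≈tr γ N = begin
    sum (m ℕ.* dJ) (λ p → G (remQuot {m} dJ p))
      ≈⟨ sum-combine m dJ _ ⟩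
    sum m (λ j → sum dJ (λ k → G (remQuot dJ (combine j k))))
      ≈⟨ sum-cong m (λ j → sum-cong dJ (λ k → reflexive (P.cong G (remQuot-combine j k)))) ⟩
    sum m (λ j → sum dJ (λ k → γ j k * Vec.⟨ column F N j , b k ⟩))
      ≈⟨ sum-cong m (λ j → trans (sum-cong dJ (λ k → *-cong refl (Vec.⟨⟩-comm _ (b k))))
                                 (sym (ap-lc (Vec.pairWith (column F N j)) dJ (γ j) b))) ⟩
    sum m (λ j → sum n (λ i → matrixOf γ (i , j) * N (i , j)))
      ≈⟨ sym (sum-swap n m _) ⟩
    tr (matrixOf γ) N ∎
    where
    G : Fin m × Fin dJ → Carrier
    G jk = γ (proj₁ jk) (proj₂ jk) * Vec.⟨ column F N (proj₁ jk) , b (proj₂ jk) ⟩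

  Mb : Fin dC[J⊥⊥] → Mat F n m
  Mb = basis hC[J⊥⊥]

  α : Fin dC[J⊥⊥] → Fin m → Fin dJ → Carrier
  α l j = proj₁ (spanning hJ (column F (Mb l) j) (J⊥⊥⊆J _ (proj₂ (basis∈ hC[J⊥⊥] l) j)))

  Mb≐matrixOfα : ∀ l → Mb l ≐ matrixOf (α l)
  Mb≐matrixOfα l (i , j) = proj₂ (spanning hJ (column F (Mb l) j) (J⊥⊥⊆J _ (proj₂ (basis∈ hC[J⊥⊥] l) j))) i

  combination-of-Mb : ∀ c i j → lc dC[J⊥⊥] c Mb (i , j) ≈ lc dJ (λ k → sum dC[J⊥⊥] (λ l → c l * α l j k)) b i
  combination-of-Mb c i j =
    trans (sum-cong dC[J⊥⊥] (λ l → *-cong refl (Mb≐matrixOfα l (i , j)))) (lc-lc dC[J⊥⊥] dJ c (λ l → α l j) b i)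

  relation∈ : ∀ l → Relations (dualCode F n m C) (m ℕ.* dJ) forms (flatten (α l))
  relation∈ l N N∈C⊥ = trans (combination≈tr (α l) N)
    (trans (tr-congˡ N (λ ij → sym (Mb≐matrixOfα l ij))) (N∈C⊥ (Mb l) (proj₁ (basis∈ hC[J⊥⊥] l))))

  relation-indep : ∀ c → lc dC[J⊥⊥] c (λ l → flatten (α l)) ≐ (λ _ → 0#) → ∀ l → c l ≈ 0#
  relation-indep c c≐0 = indep hC[J⊥⊥] c λ (i , j) →
    trans (combination-of-Mb c i j) (sum-zero dJ (λ k → trans (*-cong (coefficient≈0 j k) refl) (zeroˡ _)))
    where
    coefficient≈0 : ∀ j k → sum dC[J⊥⊥] (λ l → c l * α l j k) ≈ 0#
    coefficient≈0 j k = trans (reflexive (P.cong (λ jk → sum dC[J⊥⊥] (λ l → c l * α l (proj₁ jk) (proj₂ jk))) (P.sym (remQuot-combine j k))))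
                              (c≐0 (combine j k))

  -- A relation γ gives the matrix X = matrixOf γ in C⊥⊥ = C with columns in J,
  -- and the coordinates of X in the basis Mb are those of γ.
  relation-span : ∀ γ → Relations (dualCode F n m C) (m ℕ.* dJ) forms γ →
    Σ (Fin dC[J⊥⊥] → Carrier) λ c → γ ≐ lc dC[J⊥⊥] c (λ l → flatten (α l))
  relation-span γ γ∈ = c , λ p → trans (reflexive (P.cong γ (P.sym (combine-remQuot {m} dJ p)))) (γ'≈ _ _)
    where
    γ' : Fin m → Fin dJ → Carrier
    γ' j k = γ (combine j k)
    flatten-γ' : flatten γ' ≐ γ
    flatten-γ' p = reflexive (P.cong γ (combine-remQuot {m} dJ p))
    X∈C⊥⊥ : dualCode F n m (dualCode F n m C) (matrixOf γ')
    X∈C⊥⊥ N N∈C⊥ = begin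
      tr N (matrixOf γ')                          ≈⟨ tr-comm N _ ⟩
      tr (matrixOf γ') N                          ≈⟨ combination≈tr γ' N ⟨
      combination (m ℕ.* dJ) (flatten γ') forms N  ≈⟨ sum-cong (m ℕ.* dJ) (λ p → *-cong (flatten-γ' p) refl) ⟩
      combination (m ℕ.* dJ) γ forms N            ≈⟨ γ∈ N N∈C⊥ ⟩
      0#                                          ∎
    X∈C[J⊥⊥] : restrict F C (perp F n (perp F n J)) (matrixOf γ')
    X∈C[J⊥⊥] = C⊥⊥⊆C _ X∈C⊥⊥ , λ j → J⊆J⊥⊥ _ (lc∈ J-sub dJ (γ' j) b (basis∈ hJ))
    coords = spanning hC[J⊥⊥] (matrixOf γ') X∈C[J⊥⊥]
    c = proj₁ coords
    γ'≈ : ∀ j k → γ' j k ≈ sum dC[J⊥⊥] (λ l → c l * α l j k)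
    γ'≈ j = coords-unique hJ (γ' j) _ (λ i → trans (proj₂ coords (i , j)) (combination-of-Mb c i j))

  relations≡C[J⊥⊥] : HasDim F (Relations (dualCode F n m C) (m ℕ.* dJ) forms) dC[J⊥⊥]
  relations≡C[J⊥⊥] = record
    { basis = λ l → flatten (α l) ; basis∈ = relation∈ ; indep = relation-indep ; spanning = relation-span }

  dual-count : dC⊥[J⊥] ℕ.+ rank ≡ dC⊥
  dual-count = P.subst (λ s → s ℕ.+ rank ≡ dC⊥) (dim-unique kernel≡C⊥[J⊥] hC⊥[J⊥]) nullity+rank

  primal-count : dC[J⊥⊥] ℕ.+ rank ≡ m ℕ.* dJ
  primal-count = P.subst (λ u → u ℕ.+ rank ≡ m ℕ.* dJ) (dim-unique relations relations≡C[J⊥⊥]) corank+rank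

-- In a finite field, equality with 0 is decidable (compare enumeration indices).
≈0-dec : (F : Field) (q : ℕ) → HasCard F q → ∀ x → Dec (Field._≈_ F x (Field.0# F))
≈0-dec F q card x = compare (enum-sur x) (enum-sur 0#)
  where
  open Field F using (_≈_; 0#; trans; sym)
  open HasCard card
  compare : Σ (Fin q) (λ i → enum i ≈ x) → Σ (Fin q) (λ j → enum j ≈ 0#) → Dec (x ≈ 0#)
  compare (i , i↦x) (j , j↦0) with i Fin.≟ j
  ... | yes P.refl = yes (trans (sym i↦x) j↦0)
  ... | no i≢j     = no (λ x≈0 → i≢j (enum-inj i j (trans i↦x (trans x≈0 (sym j↦0)))))

open import Data.Integer using (ℤ; +_; _+_; _-_)
open import Data.Integer.Properties using (pos-+)
open import Data.Integer.Tactic.RingSolver using (solve-∀)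
open import Data.Nat using () renaming (_*_ to _*ℕ_)

-- The integer bookkeeping: with dim C(E⊥) = 0 and the two counts sharing the rank t,
-- ρ(J⊥) + m·dim J − ρ(E) = m·dim J − dim C(J⊥⊥) = t = τ(J).
polymatroid-arithmetic : ∀ (dC dC⊥ md dC[J⊥⊥] dC⊥[J⊥] dC[E⊥] t : ℕ) →
  dC[E⊥] ≡ 0 → dC⊥[J⊥] ℕ.+ t ≡ dC⊥ → dC[J⊥⊥] ℕ.+ t ≡ md →
  ((+ dC - + dC[J⊥⊥]) + + md) - (+ dC - + dC[E⊥]) ≡ + dC⊥ - + dC⊥[J⊥]
polymatroid-arithmetic dC _ _ a b _ t P.refl P.refl P.refl
  rewrite pos-+ a t | pos-+ b t = identity (+ dC) (+ a) (+ t) (+ b)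
  where
  identity : ∀ (c a t b : ℤ) → ((c - a) + (a + t)) - (c - + 0) ≡ (b + t) - b
  identity = solve-∀

proposition2p11 : (F : Field) (q : ℕ) → HasCard F q →
    (n m : ℕ) → .{{NonZero n}} → .{{NonZero m}} →
    (C : Mat F n m → Set) → IsSubspace F C →
    (J : Vecⁿ F n → Set) → IsSubspace F J →
    (dC dC⊥ dJ dC[J⊥⊥] dC[E⊥] dC⊥[J⊥] : ℕ) →
    HasDim F C dC →
    HasDim F (dualCode F n m C) dC⊥ →
    HasDim F J dJ →
    HasDim F (restrict F C (perp F n (perp F n J))) dC[J⊥⊥] →
    HasDim F (restrict F C (perp F n (wholeSpace F n))) dC[E⊥] →
    HasDim F (restrict F (dualCode F n m C) (perp F n J)) dC⊥[J⊥] →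
    ((+ dC - + dC[J⊥⊥]) + + (m *ℕ dJ)) - (+ dC - + dC[E⊥])
      ≡ + dC⊥ - + dC⊥[J⊥]
proposition2p11 F q card n m C C-sub J J-sub dC dC⊥ dJ dC[J⊥⊥] dC[E⊥] dC⊥[J⊥] hC hC⊥ hJ hC[J⊥⊥] hC[E⊥] hC⊥[J⊥] =
  polymatroid-arithmetic dC dC⊥ (m *ℕ dJ) dC[J⊥⊥] dC⊥[J⊥] dC[E⊥] rank
    (LinearAlgebra.dim-trivial F hC[E⊥] C[E⊥]-zero) dual-count primal-count
  where open DualityCount F (≈0-dec F q card) n m C C-sub J J-sub hC hC⊥ hJ hC[J⊥⊥] hC⊥[J⊥]
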